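{- Let $k\geq 1$ and let $x_1,\ldots,x_k$ be superadditive sequences of positive integers. Let $y(n)=e^{\Lambda(n)}$ for $n\geq 1$, where $\Lambda$ is the von Mangoldt function. For each $j$, let $n!_{x_j,y}$ denote the factorial set $(B_n)_{n\geq0}$ associated with $(x_j,y)$ (defined in the context). Then for any $s_1,\ldots,s_k\in\mathbb{N}$, not all zero, the numbers \[\sum_{n=0}^{\infty}\frac{1}{\prod_{j=1}^{k}(n!_{x_j,y})^{s_j}},\qquad \sum_{n=0}^{\infty}\frac{(-1)^n}{\prod_{j=1}^{k}(n!_{x_j,y})^{s_j}}\] are each irrational.
   Context: A sequence $x=(x(n))_{n\geq1}$ is superadditive if $x(m)+x(n)\leq x(m+n)$ for all $m,n\geq 1$. The von Mangoldt function is $\Lambda(n)=\log p$ if $n=p^r$ for a prime $p$ and integer $r\geq 1$, and $\Lambda(n)=0$ otherwise (so $y(n)$ is a positive integer). For a sequence $x$ of positive integers unbounded above with value set $\mathrm{Im}(x)$, define the array $x(n,k)$, $n,k\ge1$, recursively by: $x(1,1)=\min\mathrm{Im}(x)$; $x(n,k)=0$ whenever $n<k$; otherwise $x(n,k)$ is the smallest $a\in\mathrm{Im}(x)$ with $x(i,k)+x(n-i,k)\leq a$ for all $1\leq i\leq n-1$. The factorial set associated with $(x,y)$ is $B_0=1$, $B_n=\prod_{k=1}^n y(k)^{x(n,k)}$ for $n\ge1$; we write $n!_{x,y}:=B_n$. -}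

module Defs where

open import Data.Nat as ℕ using (ℕ; zero; suc; _+_; _*_; _∸_; _^_; _≤_; _<_; pred)
open import Data.Nat.Primality using (Prime)
open import Data.Fin using (Fin)
open import Data.List using (List; map; upTo; tabulate)
open import Data.Nat.ListAction using (product)
open import Data.Product using (Σ; ∃; _×_; _,_)
open import Data.Integer as ℤ using (ℤ; +_)
open import Data.Rational.Unnormalised as Q using (ℚᵘ; mkℚᵘ; 0ℚᵘ)
open import Relation.Binary.PropositionalEquality using (_≡_; _≢_)
open import Relation.Nullary using (¬_)

-- Sequences x = (x(n))_{n ≥ 1} are modelled as functions ℕ → ℕ; the value at 0 is irrelevant.

PositiveSeq : (ℕ → ℕ) → Set
PositiveSeq x = ∀ n → 1 ≤ n → 1 ≤ x n

Superadditive : (ℕ → ℕ) → Set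
Superadditive x = ∀ m n → 1 ≤ m → 1 ≤ n → x m + x n ≤ x (m + n)

InImage : (ℕ → ℕ) → ℕ → Set
InImage x a = ∃ λ m → 1 ≤ m × x m ≡ a

LeastInImage : (ℕ → ℕ) → (ℕ → Set) → ℕ → Set
LeastInImage x P a = InImage x a × P a × (∀ b → InImage x b → P b → a ≤ b)

-- A is the array x(n,k) (n,k ≥ 1) defined recursively in the paper:
--   x(1,1) = min Im(x); x(n,k) = 0 if n < k; otherwise x(n,k) is the smallest
--   a ∈ Im(x) with x(i,k) + x(n-i,k) ≤ a for all 1 ≤ i ≤ n-1.
-- (The recursion determines A uniquely on n,k ≥ 1; we state it as a specification.)
IsArray : (ℕ → ℕ) → (ℕ → ℕ → ℕ) → Set
IsArray x A =
  LeastInImage x (λ _ → ⊤') (A 1 1) ×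
  (∀ n k → 1 ≤ n → 1 ≤ k → n < k → A n k ≡ 0) ×
  (∀ n k → 1 ≤ n → 1 ≤ k → k ≤ n →
     LeastInImage x (λ a → ∀ i → 1 ≤ i → i ≤ n ∸ 1 → A i k + A (n ∸ i) k ≤ a) (A n k))
  where
  open import Data.Unit using () renaming (⊤ to ⊤')

IsExpVonMangoldt : (ℕ → ℕ) → Set
IsExpVonMangoldt y =
  (∀ p r → Prime p → 1 ≤ r → y (p ^ r) ≡ p) ×
  (∀ n → 1 ≤ n → (¬ ∃ λ p → ∃ λ r → Prime p × 1 ≤ r × n ≡ p ^ r) → y n ≡ 1)

factorial : (ℕ → ℕ → ℕ) → (ℕ → ℕ) → ℕ → ℕ
factorial A y n = product (map (λ k → y (suc k) ^ A n (suc k)) (upTo n))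

denom : ∀ {k} → (Fin k → ℕ → ℕ → ℕ) → (ℕ → ℕ) → (Fin k → ℕ) → ℕ → ℕ
denom A y s n = product (tabulate (λ j → factorial (A j) y n ^ s j))

-- the rational number  c / d  for d ≥ 1 (written with denominator-minus-one as ℚᵘ requires)
_over_ : ℤ → ℕ → ℚᵘ
c over d = mkℚᵘ c (pred d)

partialSum : (ℕ → ℤ) → (ℕ → ℕ) → ℕ → ℚᵘ
partialSum c D zero    = c 0 over D 0
partialSum c D (suc N) = partialSum c D N Q.+ (c (suc N) over D (suc N))

ConvergesTo : (ℕ → ℚᵘ) → ℚᵘ → Set
ConvergesTo a r = ∀ (ε : ℚᵘ) → Q.Positive ε → ∃ λ N → ∀ n → N ≤ n → Q.∣ a n Q.- r ∣ Q.≤ ε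

-- the series Σ c(n)/D(n) converges to an irrational real number:
-- its partial sums converge (Cauchy) and their limit is no rational number.
IsCauchy : (ℕ → ℚᵘ) → Set
IsCauchy a = ∀ (ε : ℚᵘ) → Q.Positive ε → ∃ λ N → ∀ m n → N ≤ m → N ≤ n → Q.∣ a m Q.- a n ∣ Q.≤ ε

SumIrrational : (ℕ → ℤ) → (ℕ → ℕ) → Set
SumIrrational c D = IsCauchy (partialSum c D) × (∀ (r : ℚᵘ) → ¬ ConvergesTo (partialSum c D) r)

one : ℕ → ℤ
one _ = + 1

alt : ℕ → ℤ
alt n = ℤ.-1ℤ ℤ.^ n

module Submission where

-- Let D(n) be the denominator and q(n) = D(n + 1) / D(n). The array recursion gives x(n, p) ≤ x(⌊n/p⌋ p, p)
-- and, when p ∣ n + 1, x(n + 1, p) ≥ x(⌊n/p⌋ p, p) + x(p, p) > x(n, p); so for a prime p ∣ n + 1 the ratio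
-- q(n) contains the factor y(p)^(x(n+1,p) − x(n,p)) ≥ p. Hence q(n) ≥ 2 for n ≥ 1, and q(M!) > M by Euclid's
-- argument. With q ≥ 2, the tails of Σ c(n)/D(n) for c = 1 and c = (−1)ⁿ are within a factor 2 of their first
-- terms; this makes the partial sums Cauchy, and since q is unbounded a rational limit a/b is impossible:
-- choosing q(N) ≥ 4b, b D(N) q(N) times the tail after N would be a multiple of q(N) of absolute value
-- between b/2 and 2b.

open import Defs
open import Data.Nat using (ℕ; zero; suc; _+_; _*_; _∸_; _^_; _≤_; _<_; s≤s; z≤n; _!; NonZero; >-nonZero; >-nonZero⁻¹; nonTrivial⇒n>1)
open import Data.Nat.Properties
open import Algebra.Properties.CommutativeSemigroup *-commutativeSemigroup using (interchange)
open import Data.Nat.DivMod using (_/_; m/n*n≤m; m*n/n≡m; +-distrib-/-∣ˡ; /-monoˡ-≤; m/n≡0⇒m<n; m/n≢0⇒n≤m; m<n*o⇒m/o<n)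
open import Data.Nat.Divisibility using (∣⇒≤; _∣_; divides; m≤n⇒m!∣n!; ∣m+n∣m⇒∣n; ∣1⇒≡1; ∣-trans)
open import Data.Nat.ListAction using (product)
open import Data.Nat.ListAction.Properties using (product-++; product≢0; ∈⇒≤product)
open import Data.Nat.Primality using (Prime; prime⇒nonTrivial)
open import Data.Nat.Primality.Factorisation using (factorise)
open import Data.Nat.Induction using (<-rec)
open import Data.Nat.Tactic.RingSolver using (solve-∀)
open import Data.Integer.Tactic.RingSolver renaming (solve-∀ to ℤ-solve-∀)
open import Data.Integer as ℤ using (ℤ; +_; +[1+_]; -[1+_])
import Data.Integer.Properties as ℤ
open import Data.Rational.Unnormalised as Q using (mkℚᵘ; *≤*; *≡*)
import Data.Rational.Unnormalised.Properties as Q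
open import Data.Fin using (Fin)
import Data.Fin as Fin
open import Data.List using ([]; _∷_; [_]; _++_; map; upTo; tabulate)
open import Data.List.Properties using (upTo-∷ʳ; map-++; tabulate-cong)
open import Data.List.Membership.Propositional.Properties using (∈-tabulate⁺)
open import Data.List.Relation.Unary.All using (_∷_)
open import Data.List.Relation.Unary.All.Properties using (tabulate⁺)
open import Data.Product using (∃; _×_; _,_; proj₁; proj₂)
open import Data.Sum using (_⊎_; inj₁; inj₂)
open import Relation.Nullary using (¬_; yes; no; contradiction)
open import Relation.Binary.PropositionalEquality using (_≡_; _≢_; refl; sym; trans; cong; cong₂; subst; subst₂; module ≡-Reasoning)
open import Function using (_∘_)

∏ : (ℕ → ℕ) → ℕ → ℕ
∏ f zero    = 1
∏ f (suc m) = ∏ f m * f m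

product-map-upTo : ∀ f m → product (map f (upTo m)) ≡ ∏ f m
product-map-upTo f zero    = refl
product-map-upTo f (suc m) = begin
  product (map f (upTo (suc m)))       ≡⟨ cong (product ∘ map f) (upTo-∷ʳ m) ⟨
  product (map f (upTo m ++ [ m ]))    ≡⟨ cong product (map-++ f (upTo m) [ m ]) ⟩
  product (map f (upTo m) ++ [ f m ])  ≡⟨ product-++ (map f (upTo m)) [ f m ] ⟩
  product (map f (upTo m)) * (f m * 1) ≡⟨ cong₂ _*_ (product-map-upTo f m) (*-identityʳ (f m)) ⟩
  ∏ f m * f m                          ∎
  where open ≡-Reasoning

∏-cong : ∀ {f g} m → (∀ k → k < m → f k ≡ g k) → ∏ f m ≡ ∏ g m
∏-cong zero    f≡g = refl
∏-cong (suc m) f≡g = cong₂ _*_ (∏-cong m (λ k k<m → f≡g k (m<n⇒m<1+n k<m))) (f≡g m (n<1+n m))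

∏-distrib-* : ∀ f g m → ∏ (λ k → f k * g k) m ≡ ∏ f m * ∏ g m
∏-distrib-* f g zero    = refl
∏-distrib-* f g (suc m) rewrite ∏-distrib-* f g m = interchange (∏ f m) (∏ g m) (f m) (g m)

∏-pos : ∀ {f} m → (∀ k → k < m → 1 ≤ f k) → 1 ≤ ∏ f m
∏-pos zero    f-pos = ≤-refl
∏-pos (suc m) f-pos = *-mono-≤ (∏-pos m (λ k k<m → f-pos k (m<n⇒m<1+n k<m))) (f-pos m (n<1+n m))

≤∏ : ∀ {f} m → (∀ k → k < m → 1 ≤ f k) → ∀ {i} → i < m → f i ≤ ∏ f m
≤∏ {f} (suc m) f-pos {i} i<1+m with m≤n⇒m<n∨m≡n (≤-pred i<1+m)
... | inj₁ i<m = ≤-trans (≤∏ m (λ k k<m → f-pos k (m<n⇒m<1+n k<m)) i<m)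
                         (m≤m*n (∏ f m) (f m) {{>-nonZero (f-pos m (n<1+n m))}})
... | inj₂ refl = m≤n*m (f i) (∏ f i) {{>-nonZero (∏-pos i (λ k k<i → f-pos k (m<n⇒m<1+n k<i)))}}

product-tabulate-* : ∀ {n} (f g : Fin n → ℕ) →
  product (tabulate (λ j → f j * g j)) ≡ product (tabulate f) * product (tabulate g)
product-tabulate-* {zero}  f g = refl
product-tabulate-* {suc n} f g rewrite product-tabulate-* (f ∘ Fin.suc) (g ∘ Fin.suc) =
  interchange (f Fin.zero) (g Fin.zero) (product (tabulate (f ∘ Fin.suc))) (product (tabulate (g ∘ Fin.suc)))

product-tabulate-pos : ∀ {n} (f : Fin n → ℕ) → (∀ j → 1 ≤ f j) → 1 ≤ product (tabulate f)
product-tabulate-pos f f-pos = >-nonZero⁻¹ _ {{product≢0 (tabulate⁺ (λ j → >-nonZero (f-pos j)))}}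

≤product-tabulate : ∀ {n} (f : Fin n → ℕ) → (∀ j → 1 ≤ f j) → ∀ j → f j ≤ product (tabulate f)
≤product-tabulate f f-pos j = ∈⇒≤product (tabulate⁺ (λ j → >-nonZero (f-pos j))) (∈-tabulate⁺ j)

1≤^ : ∀ {a} b → 1 ≤ a → 1 ≤ a ^ b
1≤^ zero    1≤a = ≤-refl
1≤^ (suc b) 1≤a = *-mono-≤ 1≤a (1≤^ b 1≤a)

≤^ : ∀ {a b} → 1 ≤ a → 1 ≤ b → a ≤ a ^ b
≤^ {a} {suc b} 1≤a _ = m≤m*n a (a ^ b) {{>-nonZero (1≤^ b 1≤a)}}

[m*n]^k≡m^k*n^k : ∀ m n k → (m * n) ^ k ≡ m ^ k * n ^ k
[m*n]^k≡m^k*n^k m n zero    = refl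
[m*n]^k≡m^k*n^k m n (suc k) rewrite [m*n]^k≡m^k*n^k m n k = interchange m n (m ^ k) (n ^ k)

product-tabulate-ones : ∀ {n} (f : Fin n → ℕ) → (∀ j → f j ≡ 1) → product (tabulate f) ≡ 1
product-tabulate-ones {zero}  f f≡1 = refl
product-tabulate-ones {suc n} f f≡1 = cong₂ _*_ (f≡1 Fin.zero) (product-tabulate-ones (f ∘ Fin.suc) (f≡1 ∘ Fin.suc))

m/o+n/o≤[m+n]/o : ∀ m n o .{{_ : NonZero o}} → m / o + n / o ≤ (m + n) / o
m/o+n/o≤[m+n]/o m n o = begin
  m / o + n / o             ≡⟨ cong (_+ n / o) (m*n/n≡m (m / o) o) ⟨
  m / o * o / o + n / o     ≡⟨ +-distrib-/-∣ˡ n (divides (m / o) refl) ⟨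
  (m / o * o + n) / o       ≤⟨ /-monoˡ-≤ o (+-monoˡ-≤ n (m/n*n≤m m o)) ⟩
  (m + n) / o               ∎
  where open ≤-Reasoning

prime⇒2≤ : ∀ {p} → Prime p → 2 ≤ p
prime⇒2≤ {p} p-prime = nonTrivial⇒n>1 p {{prime⇒nonTrivial p-prime}}

prime-divisor : ∀ m → 2 ≤ m → ∃ λ p → Prime p × p ∣ m
prime-divisor m@(suc _) 2≤m with factorise m
... | record { factors = [] ; isFactorisation = m≡1 } = contradiction (subst (2 ≤_) m≡1 2≤m) λ { (s≤s ()) }
... | record { factors = p ∷ ps ; isFactorisation = m≡p*ps ; factorsPrime = p-prime ∷ _ } =
  p , p-prime , divides (product ps) (trans m≡p*ps (*-comm p (product ps)))

large-prime-divisor : ∀ M → ∃ λ p → Prime p × M < p × p ∣ suc (M !)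
large-prime-divisor M with prime-divisor (suc (M !)) (s≤s (1≤n! M))
... | p@(suc p-1) , p-prime , p∣1+M! with M <? p
...   | yes M<p = p , p-prime , M<p , p∣1+M!
...   | no  M≮p = contradiction (∣1⇒≡1 (∣m+n∣m⇒∣n p∣M!+1 p∣M!)) p≢1
  where
  p∣M!+1 : p ∣ M ! + 1
  p∣M!+1 = subst (p ∣_) (+-comm 1 (M !)) p∣1+M!
  p∣M! : p ∣ M !
  p∣M! = ∣-trans (divides (p-1 !) (*-comm p (p-1 !))) (m≤n⇒m!∣n! (≮⇒≥ M≮p))
  p≢1 : p ≢ 1
  p≢1 p≡1 = contradiction (subst (2 ≤_) p≡1 (prime⇒2≤ p-prime)) λ { (s≤s ()) }

Unbounded : (ℕ → ℕ) → Set
Unbounded f = ∀ M → ∃ λ n → M ≤ f n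

BoundsPrimeDivisorsOfSuc : (ℕ → ℕ) → Set
BoundsPrimeDivisorsOfSuc f = ∀ {n p} → 1 ≤ n → Prime p → p ∣ suc n → p ≤ f n

module _ {f : ℕ → ℕ} (bounds : BoundsPrimeDivisorsOfSuc f) where

  bounds-prime-divisors⇒2≤ : ∀ {n} → 1 ≤ n → 2 ≤ f n
  bounds-prime-divisors⇒2≤ {n} 1≤n with prime-divisor (suc n) (s≤s 1≤n)
  ... | p , p-prime , p∣1+n = ≤-trans (prime⇒2≤ p-prime) (bounds 1≤n p-prime p∣1+n)

  bounds-prime-divisors⇒unbounded : Unbounded f
  bounds-prime-divisors⇒unbounded M with large-prime-divisor M
  ... | p , p-prime , M<p , p∣1+M! = M ! , ≤-trans (<⇒≤ M<p) (bounds (1≤n! M) p-prime p∣1+M!)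

module Array {x : ℕ → ℕ} (x-pos : PositiveSeq x) {B : ℕ → ℕ → ℕ} (array : IsArray x B) where

  B-zero : ∀ {n k} → 1 ≤ n → n < k → B n k ≡ 0
  B-zero {n} {k} 1≤n n<k = proj₁ (proj₂ array) n k 1≤n (≤-trans 1≤n (<⇒≤ n<k)) n<k

  private
    recursion : ∀ {n k} → 1 ≤ k → k ≤ n →
      LeastInImage x (λ a → ∀ i → 1 ≤ i → i ≤ n ∸ 1 → B i k + B (n ∸ i) k ≤ a) (B n k)
    recursion {n} {k} 1≤k k≤n = proj₂ (proj₂ array) n k (≤-trans 1≤k k≤n) 1≤k k≤n

  B-inImage : ∀ {n k} → 1 ≤ k → k ≤ n → InImage x (B n k)
  B-inImage 1≤k k≤n = proj₁ (recursion 1≤k k≤n)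

  B-pos : ∀ {n k} → 1 ≤ k → k ≤ n → 1 ≤ B n k
  B-pos 1≤k k≤n with B-inImage 1≤k k≤n
  ... | m , 1≤m , xm≡Bnk = subst (1 ≤_) xm≡Bnk (x-pos m 1≤m)

  B-split : ∀ {n k i} → 1 ≤ k → k ≤ n → 1 ≤ i → i < n → B i k + B (n ∸ i) k ≤ B n k
  B-split {i = i} 1≤k k≤n 1≤i (s≤s i≤n-1) = proj₁ (proj₂ (recursion 1≤k k≤n)) i 1≤i i≤n-1

  B-least : ∀ {n k a} → 1 ≤ k → k ≤ n → InImage x a →
            (∀ {i} → 1 ≤ i → i < n → B i k + B (n ∸ i) k ≤ a) → B n k ≤ a
  B-least {zero}  (s≤s _) ()
  B-least {suc _} 1≤k k≤n a∈x split≤a =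
    proj₂ (proj₂ (recursion 1≤k k≤n)) _ a∈x λ i 1≤i i≤n-1 → split≤a 1≤i (s≤s i≤n-1)

  B-mono : ∀ {m n k} → 1 ≤ k → 1 ≤ m → m ≤ n → B m k ≤ B n k
  B-mono {m} {n} {k} 1≤k 1≤m m≤n with m≤n⇒m<n∨m≡n m≤n | k ≤? n
  ... | inj₂ refl | _       = ≤-refl
  ... | inj₁ m<n  | yes k≤n = ≤-trans (m≤m+n (B m k) _) (B-split 1≤k k≤n 1≤m m<n)
  ... | inj₁ m<n  | no  k≰n =
    ≤-reflexive (trans (B-zero 1≤m (≤-<-trans m≤n n<k)) (sym (B-zero (≤-trans 1≤m m≤n) n<k)))
    where n<k = ≰⇒> k≰n

  module AtMultiplesOf (p : ℕ) .{{_ : NonZero p}} where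

    1≤p : 1 ≤ p
    1≤p = >-nonZero⁻¹ p

    p≤a*p : ∀ {a} → 1 ≤ a → p ≤ a * p
    p≤a*p {a} 1≤a = m≤n*m p a {{>-nonZero 1≤a}}

    -- x(a p, p), extended by 0 at a = 0 where the array is not defined.
    atMultiple : ℕ → ℕ
    atMultiple zero        = 0
    atMultiple a@(suc _)   = B (a * p) p

    atMultiple-mono : ∀ {a c} → a ≤ c → atMultiple a ≤ atMultiple c
    atMultiple-mono {zero}            _   = z≤n
    atMultiple-mono {a@(suc _)} {suc _} a≤c =
      B-mono 1≤p (≤-trans 1≤p (p≤a*p {a} (s≤s z≤n))) (*-monoˡ-≤ p a≤c)

    atMultiple-super : ∀ a c → atMultiple a + atMultiple c ≤ atMultiple (a + c)
    atMultiple-super zero c = ≤-refl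
    atMultiple-super a@(suc _) zero = ≤-reflexive (trans (+-identityʳ _) (cong atMultiple (sym (+-identityʳ a))))
    atMultiple-super a@(suc _) c@(suc _) =
      subst (λ m → atMultiple a + B m p ≤ atMultiple (a + c)) [a+c]p∸ap≡cp
        (B-split 1≤p (p≤a*p {a + c} (s≤s z≤n)) (≤-trans 1≤p (p≤a*p {a} (s≤s z≤n))) ap<[a+c]p)
      where
      [a+c]p≡ap+cp : (a + c) * p ≡ a * p + c * p
      [a+c]p≡ap+cp = *-distribʳ-+ p a c
      [a+c]p∸ap≡cp : (a + c) * p ∸ a * p ≡ c * p
      [a+c]p∸ap≡cp = trans (cong (_∸ a * p) [a+c]p≡ap+cp) (m+n∸m≡n (a * p) (c * p))
      ap<[a+c]p : a * p < (a + c) * p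
      ap<[a+c]p = subst (a * p <_) (sym [a+c]p≡ap+cp) (m<m+n (a * p) (≤-trans 1≤p (p≤a*p {c} (s≤s z≤n))))

    atMultiple-+ : ∀ a c {m} → a + c ≤ m → atMultiple a + atMultiple c ≤ atMultiple m
    atMultiple-+ a c a+c≤m = ≤-trans (atMultiple-super a c) (atMultiple-mono a+c≤m)

    -- The quotients by p of the two parts of a split i + (n − i) sum to at most ⌊n/p⌋.
    B≤atMultiple : ∀ n → 1 ≤ n → B n p ≤ atMultiple (n / p)
    B≤atMultiple = <-rec _ step
      where
      step : ∀ n → (∀ {m} → m < n → 1 ≤ m → B m p ≤ atMultiple (m / p)) →
             1 ≤ n → B n p ≤ atMultiple (n / p)
      step n ih 1≤n with n / p in n/p≡
      ... | zero  = ≤-reflexive (B-zero 1≤n (m/n≡0⇒m<n n/p≡))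
      ... | suc a = B-least 1≤p p≤n (B-inImage 1≤p (p≤a*p {suc a} (s≤s z≤n))) λ {i} 1≤i i<n → begin
        B i p + B (n ∸ i) p                            ≤⟨ +-mono-≤ (ih i<n 1≤i) (ih (∸-monoʳ-< 1≤i (<⇒≤ i<n)) (m<n⇒0<n∸m i<n)) ⟩
        atMultiple (i / p) + atMultiple ((n ∸ i) / p)  ≤⟨ atMultiple-+ (i / p) ((n ∸ i) / p) (m/o+n/o≤[m+n]/o i (n ∸ i) p) ⟩
        atMultiple ((i + (n ∸ i)) / p)                 ≡⟨ cong (λ m → atMultiple (m / p)) (m+[n∸m]≡n (<⇒≤ i<n)) ⟩
        atMultiple (n / p)                             ≡⟨ cong atMultiple n/p≡ ⟩
        atMultiple (suc a)                             ∎
        where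
        open ≤-Reasoning
        p≤n : p ≤ n
        p≤n = m/n≢0⇒n≤m (λ n/p≡0 → 0≢1+n (trans (sym n/p≡0) n/p≡))

    B-jump : ∀ {n} → 1 ≤ n → p ∣ suc n → B n p < B (suc n) p
    B-jump {n} 1≤n (divides t@(suc _) 1+n≡tp) = begin-strict
      B n p                              ≤⟨ B≤atMultiple n 1≤n ⟩
      atMultiple (n / p)                 <⟨ m<m+n _ (B-pos 1≤p (p≤a*p {1} ≤-refl)) ⟩
      atMultiple (n / p) + atMultiple 1  ≤⟨ atMultiple-+ (n / p) 1 (subst (_≤ t) (+-comm 1 (n / p)) n/p<t) ⟩
      atMultiple t                       ≡⟨ cong (λ m → B m p) 1+n≡tp ⟨
      B (suc n) p                        ∎
      where
      open ≤-Reasoning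
      n/p<t : n / p < t
      n/p<t = m<n*o⇒m/o<n (subst (n <_) 1+n≡tp (n<1+n n))

module ExpVonMangoldt {y : ℕ → ℕ} (y-spec : IsExpVonMangoldt y) where

  y-prime : ∀ {p} → Prime p → y p ≡ p
  y-prime {p} p-prime = subst (λ m → y m ≡ p) (*-identityʳ p) (proj₁ y-spec p 1 p-prime ≤-refl)

  y-pos : ∀ {m} → 1 ≤ m → 1 ≤ y m
  y-pos {m} 1≤m with y m in ym≡
  ... | suc _ = s≤s z≤n
  ... | zero  = contradiction (trans (sym ym≡) (proj₂ y-spec m 1≤m not-prime-power)) λ ()
    where
    not-prime-power : ¬ ∃ λ p → ∃ λ r → Prime p × 1 ≤ r × m ≡ p ^ r
    not-prime-power (p , r , p-prime , 1≤r , m≡p^r) =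
      contradiction (trans (sym ym≡) (trans (cong y m≡p^r) (proj₁ y-spec p r p-prime 1≤r)))
                    (λ 0≡p → contradiction (subst (2 ≤_) (sym 0≡p) (prime⇒2≤ p-prime)) λ ())

module FactorialRatio {x : ℕ → ℕ} (x-pos : PositiveSeq x) {B : ℕ → ℕ → ℕ} (array : IsArray x B)
                      {y : ℕ → ℕ} (y-spec : IsExpVonMangoldt y) where
  open Array x-pos array
  open ExpVonMangoldt y-spec

  factor : ℕ → ℕ → ℕ
  factor n k = y (suc k) ^ B n (suc k)

  increment : ℕ → ℕ → ℕ
  increment n k = y (suc k) ^ (B (suc n) (suc k) ∸ B n (suc k))

  -- The last factor is kept apart: x(n, n+1) = 0, but x(0, 1) is not specified.
  ratio : ℕ → ℕ
  ratio n = ∏ (increment n) n * factor (suc n) n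

  factorial-suc : ∀ n → factorial B y (suc n) ≡ factorial B y n * ratio n
  factorial-suc n = begin
    factorial B y (suc n)                            ≡⟨ product-map-upTo (factor (suc n)) (suc n) ⟩
    ∏ (factor (suc n)) n * factor (suc n) n          ≡⟨ cong (_* factor (suc n) n) (∏-cong n factor-suc) ⟩
    ∏ (λ k → factor n k * increment n k) n * factor (suc n) n
                                                     ≡⟨ cong (_* factor (suc n) n) (∏-distrib-* (factor n) (increment n) n) ⟩
    ∏ (factor n) n * ∏ (increment n) n * factor (suc n) n
                                                     ≡⟨ *-assoc (∏ (factor n) n) _ _ ⟩
    ∏ (factor n) n * ratio n                         ≡⟨ cong (_* ratio n) (product-map-upTo (factor n) n) ⟨
    factorial B y n * ratio n                        ∎
    where
    open ≡-Reasoning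
    factor-suc : ∀ k → k < n → factor (suc n) k ≡ factor n k * increment n k
    factor-suc k k<n = trans (cong (y (suc k) ^_) (sym (m+[n∸m]≡n (B-mono (s≤s z≤n) (≤-trans (s≤s z≤n) k<n) (n≤1+n n)))))
                             (^-distribˡ-+-* (y (suc k)) (B n (suc k)) _)

  factor-pos : ∀ n k → 1 ≤ factor n k
  factor-pos n k = 1≤^ (B n (suc k)) (y-pos {suc k} (s≤s z≤n))

  increment-pos : ∀ n k → 1 ≤ increment n k
  increment-pos n k = 1≤^ (B (suc n) (suc k) ∸ B n (suc k)) (y-pos {suc k} (s≤s z≤n))

  ∏increment-pos : ∀ n → 1 ≤ ∏ (increment n) n
  ∏increment-pos n = ∏-pos n (λ k _ → increment-pos n k)

  ratio-pos : ∀ n → 1 ≤ ratio n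
  ratio-pos n = *-mono-≤ (∏increment-pos n) (factor-pos (suc n) n)

  ratio-bounds-prime-divisors : BoundsPrimeDivisorsOfSuc ratio
  ratio-bounds-prime-divisors {n} {p@(suc k)} 1≤n p-prime p∣1+n with m≤n⇒m<n∨m≡n (∣⇒≤ p∣1+n)
  ... | inj₁ (s≤s k<n) = begin
    p                       ≤⟨ ≤^ (s≤s z≤n) (m<n⇒0<n∸m (B-jump 1≤n p∣1+n)) ⟩
    p ^ (B (suc n) p ∸ B n p) ≡⟨ cong (λ b → b ^ (B (suc n) p ∸ B n p)) (y-prime p-prime) ⟨
    increment n k           ≤⟨ ≤∏ n (λ k _ → increment-pos n k) k<n ⟩
    ∏ (increment n) n       ≤⟨ m≤m*n _ (factor (suc n) n) {{>-nonZero (factor-pos (suc n) n)}} ⟩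
    ratio n                 ∎
    where
    open ≤-Reasoning
    open AtMultiplesOf p
  ... | inj₂ refl = begin
    p                       ≤⟨ ≤^ (s≤s z≤n) (B-pos (s≤s z≤n) ≤-refl) ⟩
    p ^ B p p               ≡⟨ cong (_^ B p p) (y-prime p-prime) ⟨
    factor p k              ≤⟨ m≤n*m _ (∏ (increment k) k) {{>-nonZero (∏increment-pos k)}} ⟩
    ratio k                 ∎
    where open ≤-Reasoning

module Denominator {k} {x : Fin k → ℕ → ℕ} (x-pos : ∀ j → PositiveSeq (x j))
                   {A : Fin k → ℕ → ℕ → ℕ} (arrays : ∀ j → IsArray (x j) (A j))
                   {y : ℕ → ℕ} (y-spec : IsExpVonMangoldt y) (s : Fin k → ℕ) where
  private
    module R (j : Fin k) = FactorialRatio (x-pos j) (arrays j) y-spec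

  ratio : ℕ → ℕ
  ratio n = product (tabulate (λ j → R.ratio j n ^ s j))

  denom-zero : denom A y s 0 ≡ 1
  denom-zero = product-tabulate-ones (λ j → 1 ^ s j) (λ j → ^-zeroˡ (s j))

  denom-suc : ∀ n → denom A y s (suc n) ≡ denom A y s n * ratio n
  denom-suc n = trans
    (cong product (tabulate-cong λ j → trans (cong (_^ s j) (R.factorial-suc j n)) ([m*n]^k≡m^k*n^k _ _ (s j))))
    (product-tabulate-* (λ j → factorial (A j) y n ^ s j) (λ j → R.ratio j n ^ s j))

  ratio^s-pos : ∀ n j → 1 ≤ R.ratio j n ^ s j
  ratio^s-pos n j = 1≤^ (s j) (R.ratio-pos j n)

  ratio-pos : ∀ n → 1 ≤ ratio n
  ratio-pos n = product-tabulate-pos _ (ratio^s-pos n)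

  ratio-bounds-prime-divisors : ∀ j → 1 ≤ s j → BoundsPrimeDivisorsOfSuc ratio
  ratio-bounds-prime-divisors j 1≤sj {n} {p} 1≤n p-prime p∣1+n = begin
    p                 ≤⟨ R.ratio-bounds-prime-divisors j 1≤n p-prime p∣1+n ⟩
    R.ratio j n       ≤⟨ ≤^ (R.ratio-pos j n) 1≤sj ⟩
    R.ratio j n ^ s j ≤⟨ ≤product-tabulate _ (ratio^s-pos n) j ⟩
    ratio n           ∎
    where open ≤-Reasoning

private
  distance-numerator : ∀ X Y d₁ d₂ →
    ℤ.∣ X ℤ.* + suc d₂ ℤ.- Y ℤ.* + suc d₁ ∣ ≡ ℤ.∣ X ℤ.* + suc d₂ ℤ.+ ℤ.- Y ℤ.* + suc d₁ ∣
  distance-numerator X Y d₁ d₂ = cong (λ t → ℤ.∣ X ℤ.* + suc d₂ ℤ.+ t ∣) (ℤ.neg-distribˡ-* Y (+ suc d₁))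

cross-≤⇒distance-≤ : ∀ (X Y : ℤ) {D₁ D₂ E} e → 1 ≤ D₁ → 1 ≤ D₂ → 1 ≤ E →
  ℤ.∣ X ℤ.* + D₂ ℤ.- Y ℤ.* + D₁ ∣ * E ≤ e * (D₁ * D₂) →
  Q.∣ X over D₁ Q.- Y over D₂ ∣ Q.≤ (+ e) over E
cross-≤⇒distance-≤ X Y {D₁@(suc d₁)} {D₂@(suc d₂)} {E@(suc _)} e _ _ _ h
  rewrite distance-numerator X Y d₁ d₂ =
    *≤* (subst₂ ℤ._≤_ (ℤ.pos-* ℤ.∣ X ℤ.* + D₂ ℤ.+ ℤ.- Y ℤ.* + D₁ ∣ E) (ℤ.pos-* e (D₁ * D₂)) (ℤ.+≤+ h))

distance-≤⇒cross-≤ : ∀ (X Y : ℤ) {D₁ D₂ E} e → 1 ≤ D₁ → 1 ≤ D₂ → 1 ≤ E →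
  Q.∣ X over D₁ Q.- Y over D₂ ∣ Q.≤ (+ e) over E →
  ℤ.∣ X ℤ.* + D₂ ℤ.- Y ℤ.* + D₁ ∣ * E ≤ e * (D₁ * D₂)
distance-≤⇒cross-≤ X Y {D₁@(suc d₁)} {D₂@(suc d₂)} {E@(suc _)} e _ _ _ (*≤* h)
  rewrite distance-numerator X Y d₁ d₂ =
    ℤ.drop‿+≤+ (subst₂ ℤ._≤_ (sym (ℤ.pos-* ℤ.∣ X ℤ.* + D₂ ℤ.+ ℤ.- Y ℤ.* + D₁ ∣ E)) (sym (ℤ.pos-* e (D₁ * D₂))) h)

over-+-over-* : ∀ X Y {d e} → 1 ≤ d → 1 ≤ e → X over d Q.+ Y over (d * e) Q.≃ (X ℤ.* + e ℤ.+ Y) over (d * e)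
over-+-over-* X Y {d@(suc _)} {e@(suc _)} _ _ = *≡* (subst₂
  (λ de dde → (X ℤ.* de ℤ.+ Y ℤ.* + d) ℤ.* de ≡ (X ℤ.* + e ℤ.+ Y) ℤ.* dde)
  (sym (ℤ.pos-* d e)) (sym (trans (ℤ.pos-* d (d * e)) (cong (+ d ℤ.*_) (ℤ.pos-* d e))))
  (cross X Y (+ d) (+ e)))
  where
  cross : ∀ X Y d e → (X ℤ.* (d ℤ.* e) ℤ.+ Y ℤ.* d) ℤ.* (d ℤ.* e) ≡ (X ℤ.* e ℤ.+ Y) ℤ.* (d ℤ.* (d ℤ.* e))
  cross = ℤ-solve-∀

IsSign : ℤ → Set
IsSign σ = σ ℤ.* σ ≡ ℤ.1ℤ

∣sign∣≡1 : ∀ {σ} → IsSign σ → ℤ.∣ σ ∣ ≡ 1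
∣sign∣≡1 {σ} σ² = m*n≡1⇒n≡1 ℤ.∣ σ ∣ ℤ.∣ σ ∣ (trans (sym (ℤ.abs-* σ σ)) (cong ℤ.∣_∣ σ²))

∣sign*i∣≡∣i∣ : ∀ {σ} i → IsSign σ → ℤ.∣ σ ℤ.* i ∣ ≡ ℤ.∣ i ∣
∣sign*i∣≡∣i∣ {σ} i σ² = trans (ℤ.abs-* σ i) (trans (cong (_* ℤ.∣ i ∣) (∣sign∣≡1 {σ} σ²)) (*-identityˡ _))

alt-suc : ∀ n → alt (suc n) ≡ ℤ.- alt n
alt-suc n = ℤ.-1*i≡-i (alt n)

alt-sign : ∀ n → IsSign (alt n)
alt-sign zero    = refl
alt-sign (suc n) = begin
  alt (suc n) ℤ.* alt (suc n)   ≡⟨ cong₂ ℤ._*_ (alt-suc n) (alt-suc n) ⟩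
  ℤ.- alt n ℤ.* ℤ.- alt n       ≡⟨ ℤ.neg-distribʳ-* (ℤ.- alt n) (alt n) ⟨
  ℤ.- (ℤ.- alt n ℤ.* alt n)     ≡⟨ cong ℤ.-_ (ℤ.neg-distribˡ-* (alt n) (alt n)) ⟨
  ℤ.- ℤ.- (alt n ℤ.* alt n)     ≡⟨ ℤ.neg-involutive _ ⟩
  alt n ℤ.* alt n               ≡⟨ alt-sign n ⟩
  ℤ.1ℤ                          ∎
  where open ≡-Reasoning

R≤∣x-zR∣+x : ∀ x R (z : ℤ) → R ≤ ℤ.∣ z ∣ * R → R ≤ ℤ.∣ + x ℤ.- z ℤ.* + R ∣ + x
R≤∣x-zR∣+x x R z R≤∣z∣R = begin
  R                                 ≤⟨ R≤∣z∣R ⟩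
  ℤ.∣ z ∣ * R                       ≡⟨ ℤ.abs-* z (+ R) ⟨
  ℤ.∣ z ℤ.* + R ∣                   ≡⟨ cong ℤ.∣_∣ (y≡a-[a-y] (+ x) (z ℤ.* + R)) ⟩
  ℤ.∣ + x ℤ.- (+ x ℤ.- z ℤ.* + R) ∣ ≤⟨ ℤ.∣i-j∣≤∣i∣+∣j∣ (+ x) (+ x ℤ.- z ℤ.* + R) ⟩
  x + ℤ.∣ + x ℤ.- z ℤ.* + R ∣       ≡⟨ +-comm x _ ⟩
  ℤ.∣ + x ℤ.- z ℤ.* + R ∣ + x       ∎
  where
  open ≤-Reasoning
  y≡a-[a-y] : ∀ (a y : ℤ) → y ≡ a ℤ.- (a ℤ.- y)
  y≡a-[a-y] = ℤ-solve-∀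

∣x-zR∣≡x⊎R≤∣x-zR∣+x : ∀ x R (z : ℤ) → ℤ.∣ + x ℤ.- z ℤ.* + R ∣ ≡ x ⊎ R ≤ ℤ.∣ + x ℤ.- z ℤ.* + R ∣ + x
∣x-zR∣≡x⊎R≤∣x-zR∣+x x R (+ zero) = inj₁ (+-identityʳ x)
∣x-zR∣≡x⊎R≤∣x-zR∣+x x R z@(+[1+ k ]) = inj₂ (R≤∣x-zR∣+x x R z (m≤n*m R (suc k)))
∣x-zR∣≡x⊎R≤∣x-zR∣+x x R z@(-[1+ k ]) = inj₂ (R≤∣x-zR∣+x x R z (m≤n*m R (suc k)))

-- Either z = 0 and the left side is 4vb ≥ 2Rb, or ∣vb − zqR∣ ≥ qR − vb ≥ 4bR − 2Rb.
far-from-multiples : ∀ (z : ℤ) {q b v R} → 1 ≤ b → 1 ≤ R → 4 * b ≤ q → R ≤ 2 * v → v ≤ 2 * R →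
  ¬ 4 * ℤ.∣ + (v * b) ℤ.- z ℤ.* + (q * R) ∣ ≤ R * b
far-from-multiples z {q} {b} {v} {R} 1≤b 1≤R 4b≤q R≤2v v≤2R 4T≤Rb
  with ∣x-zR∣≡x⊎R≤∣x-zR∣+x (v * b) (q * R) z
... | inj₁ T≡vb = contradiction (≤-trans 1≤R (≤-trans R≤2v 2v≤0)) λ ()
  where
  4v≤R : 4 * v ≤ R
  4v≤R = *-cancelʳ-≤ (4 * v) R b {{>-nonZero 1≤b}}
           (subst (_≤ R * b) (trans (cong (4 *_) T≡vb) (sym (*-assoc 4 v b))) 4T≤Rb)
  2v≤0 : 2 * v ≤ 0
  2v≤0 = +-cancelˡ-≤ (2 * v) (2 * v) 0
           (subst₂ _≤_ (double v) (sym (+-identityʳ (2 * v))) (≤-trans 4v≤R R≤2v))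
    where
    double : ∀ v → 4 * v ≡ 2 * v + 2 * v
    double = solve-∀
... | inj₂ qR≤T+vb = contradiction (≤-trans (*-mono-≤ 1≤b 1≤R) bR≤0) λ ()
  where
  T = ℤ.∣ + (v * b) ℤ.- z ℤ.* + (q * R) ∣
  x = b * R
  16bR≤9bR : 9 * x + 7 * x ≤ 9 * x + 0
  16bR≤9bR = begin
    9 * x + 7 * x        ≡⟨ e₁ b R ⟩
    (4 * b) * (4 * R)    ≤⟨ *-monoˡ-≤ (4 * R) 4b≤q ⟩
    q * (4 * R)          ≡⟨ e₂ q R ⟩
    4 * (q * R)          ≤⟨ *-monoʳ-≤ 4 qR≤T+vb ⟩
    4 * (T + v * b)      ≡⟨ *-distribˡ-+ 4 T (v * b) ⟩
    4 * T + 4 * (v * b)  ≤⟨ +-mono-≤ 4T≤Rb (*-monoʳ-≤ 4 (*-monoˡ-≤ b v≤2R)) ⟩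
    R * b + 4 * (2 * R * b) ≡⟨ e₃ b R ⟩
    9 * x + 0            ∎
    where
    open ≤-Reasoning
    e₁ : ∀ b r → 9 * (b * r) + 7 * (b * r) ≡ (4 * b) * (4 * r)
    e₁ = solve-∀
    e₂ : ∀ q r → q * (4 * r) ≡ 4 * (q * r)
    e₂ = solve-∀
    e₃ : ∀ b r → r * b + 4 * (2 * r * b) ≡ 9 * (b * r) + 0
    e₃ = solve-∀
  bR≤0 : x ≤ 0
  bR≤0 = ≤-trans (m≤n*m x 7) (+-cancelˡ-≤ (9 * x) (7 * x) 0 16bR≤9bR)

m*n+n≡[m+1]*n : ∀ m n → m * n + n ≡ (m + 1) * n
m*n+n≡[m+1]*n = solve-∀

vQ-1-bounds : ∀ v R Q → 2 ≤ Q → v ≤ R → R + 1 ≤ 2 * v →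
  ∃ λ v′ → v * Q ≡ suc v′ × v′ + 1 ≤ R * Q × R * Q ≤ 2 * v′
vQ-1-bounds zero R Q 2≤Q v≤R R+1≤2v = contradiction (≤-trans (m≤n+m 1 R) R+1≤2v) λ ()
vQ-1-bounds v@(suc v-1) R Q@(suc Q-1) 2≤Q v≤R R+1≤2v = v′ , refl , v′+1≤RQ , RQ≤2v′
  where
  v′ = Q-1 + v-1 * Q
  v′+1≤RQ : v′ + 1 ≤ R * Q
  v′+1≤RQ = subst (_≤ R * Q) (+-comm 1 v′) (*-monoˡ-≤ Q v≤R)
  RQ≤2v′ : R * Q ≤ 2 * v′
  RQ≤2v′ = +-cancelʳ-≤ 2 (R * Q) (2 * v′) (begin
    R * Q + 2      ≤⟨ +-monoʳ-≤ (R * Q) 2≤Q ⟩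
    R * Q + Q      ≡⟨ m*n+n≡[m+1]*n R Q ⟩
    (R + 1) * Q    ≤⟨ *-monoˡ-≤ Q R+1≤2v ⟩
    2 * v * Q      ≡⟨ expand v-1 Q-1 ⟩
    2 * v′ + 2     ∎)
    where
    open ≤-Reasoning
    expand : ∀ v-1 Q-1 → 2 * suc v-1 * suc Q-1 ≡ 2 * (Q-1 + v-1 * suc Q-1) + 2
    expand = solve-∀

vQ+1-bounds : ∀ v R Q → 2 ≤ Q → v + 1 ≤ R → R ≤ 2 * v →
  v * Q + 1 ≤ R * Q × R * Q + 1 ≤ 2 * (v * Q + 1)
vQ+1-bounds v R Q 2≤Q v+1≤R R≤2v = vQ+1≤RQ , RQ+1≤2[vQ+1]
  where
  open ≤-Reasoning
  vQ+1≤RQ : v * Q + 1 ≤ R * Q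
  vQ+1≤RQ = begin
    v * Q + 1      ≤⟨ +-monoʳ-≤ (v * Q) (≤-trans (s≤s z≤n) 2≤Q) ⟩
    v * Q + Q      ≡⟨ m*n+n≡[m+1]*n v Q ⟩
    (v + 1) * Q    ≤⟨ *-monoˡ-≤ Q v+1≤R ⟩
    R * Q          ∎
  RQ+1≤2[vQ+1] : R * Q + 1 ≤ 2 * (v * Q + 1)
  RQ+1≤2[vQ+1] = begin
    R * Q + 1       ≤⟨ +-monoˡ-≤ 1 (*-monoˡ-≤ Q R≤2v) ⟩
    2 * v * Q + 1   ≤⟨ +-monoʳ-≤ (2 * v * Q) (n≤1+n 1) ⟩
    2 * v * Q + 2   ≡⟨ distrib v Q ⟩
    2 * (v * Q + 1) ∎
    where
    distrib : ∀ v Q → 2 * v * Q + 2 ≡ 2 * (v * Q + 1)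
    distrib = solve-∀

module Series (D q : ℕ → ℕ) (D-zero : D 0 ≡ 1) (D-suc : ∀ n → D (suc n) ≡ D n * q n)
              (q-pos : ∀ n → 1 ≤ q n) (2≤q : ∀ {n} → 1 ≤ n → 2 ≤ q n) where

  D-pos : ∀ n → 1 ≤ D n
  D-pos zero    = ≤-reflexive (sym D-zero)
  D-pos (suc n) = subst (1 ≤_) (sym (D-suc n)) (*-mono-≤ (D-pos n) (q-pos n))

  n≤D : ∀ n → n ≤ D n
  n≤D zero            = z≤n
  n≤D (suc zero)      = D-pos 1
  n≤D (suc n@(suc _)) = begin
    suc n      ≤⟨ s≤s (n≤D n) ⟩
    suc (D n)  ≤⟨ +-monoˡ-≤ (D n) (D-pos n) ⟩
    D n + D n  ≡⟨ m+m≡m*2 (D n) ⟩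
    D n * 2    ≤⟨ *-monoʳ-≤ (D n) (2≤q (s≤s z≤n)) ⟩
    D n * q n  ≡⟨ D-suc n ⟨
    D (suc n)  ∎
    where
    open ≤-Reasoning
    m+m≡m*2 : ∀ m → m + m ≡ m * 2
    m+m≡m*2 = solve-∀

  numerator : (ℕ → ℤ) → ℕ → ℤ
  numerator c zero    = c 0
  numerator c (suc n) = numerator c n ℤ.* + q n ℤ.+ c (suc n)

  partialSum≃numerator/D : ∀ c n → partialSum c D n Q.≃ numerator c n over D n
  partialSum≃numerator/D c zero    = Q.≃-refl
  partialSum≃numerator/D c (suc n) = Q.≃-trans (Q.+-cong (partialSum≃numerator/D c n) Q.≃-refl)
    (subst (λ d → numerator c n over D n Q.+ c (suc n) over d Q.≃ numerator c (suc n) over d)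
           (sym (D-suc n)) (over-+-over-* (numerator c n) (c (suc n)) (D-pos n) (q-pos n)))

  growth : ℕ → ℕ → ℕ
  growth N zero    = 1
  growth N (suc j) = growth N j * q (j + N)

  growthAfter : ℕ → ℕ → ℕ
  growthAfter N zero    = 1
  growthAfter N (suc i) = growthAfter N i * q (suc i + N)

  growth-pos : ∀ N j → 1 ≤ growth N j
  growth-pos N zero    = ≤-refl
  growth-pos N (suc j) = *-mono-≤ (growth-pos N j) (q-pos (j + N))

  growthAfter-pos : ∀ N i → 1 ≤ growthAfter N i
  growthAfter-pos N zero    = ≤-refl
  growthAfter-pos N (suc i) = *-mono-≤ (growthAfter-pos N i) (q-pos (suc i + N))

  growth-suc : ∀ N i → growth N (suc i) ≡ q N * growthAfter N i
  growth-suc N zero    = trans (*-identityˡ (q N)) (sym (*-identityʳ (q N)))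
  growth-suc N (suc i) = trans (cong (_* q (suc i + N)) (growth-suc N i)) (*-assoc (q N) (growthAfter N i) _)

  growthAfter≤growth : ∀ N i → growthAfter N i ≤ growth N (suc i)
  growthAfter≤growth N i = subst (growthAfter N i ≤_) (sym (growth-suc N i))
                                 (m≤n*m (growthAfter N i) (q N) {{>-nonZero (q-pos N)}})

  D-split : ∀ N j → D (j + N) ≡ D N * growth N j
  D-split N zero    = sym (*-identityʳ (D N))
  D-split N (suc j) = begin
    D (suc j + N)                  ≡⟨ D-suc (j + N) ⟩
    D (j + N) * q (j + N)          ≡⟨ cong (_* q (j + N)) (D-split N j) ⟩
    D N * growth N j * q (j + N)   ≡⟨ *-assoc (D N) (growth N j) (q (j + N)) ⟩
    D N * growth N (suc j)         ∎
    where open ≡-Reasoning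

  -- tail c σ N j = σ D(N + j) (S(N + j) − S(N)), where S is the partial sum: see numerator-split.
  tail : (ℕ → ℤ) → ℤ → ℕ → ℕ → ℤ
  tail c σ N zero    = + 0
  tail c σ N (suc j) = tail c σ N j ℤ.* + q (j + N) ℤ.+ σ ℤ.* c (suc j + N)

  numerator-split : ∀ c σ N j → IsSign σ →
    numerator c (j + N) ≡ numerator c N ℤ.* + growth N j ℤ.+ σ ℤ.* tail c σ N j
  numerator-split c σ N zero σ² = sym (trans (cong₂ ℤ._+_ (ℤ.*-identityʳ (numerator c N)) (ℤ.*-zeroʳ σ))
                                               (ℤ.+-identityʳ (numerator c N)))
  numerator-split c σ N (suc j) σ² = begin
    numerator c (j + N) ℤ.* + q (j + N) ℤ.+ c (suc j + N)
      ≡⟨ cong (λ P → P ℤ.* + q (j + N) ℤ.+ c (suc j + N)) (numerator-split c σ N j σ²) ⟩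
    (A ℤ.* + growth N j ℤ.+ σ ℤ.* tail c σ N j) ℤ.* + q (j + N) ℤ.+ c (suc j + N)
      ≡⟨ expand A σ (tail c σ N j) (c (suc j + N)) (+ growth N j) (+ q (j + N)) ⟩
    A ℤ.* (+ growth N j ℤ.* + q (j + N)) ℤ.+ σ ℤ.* tail c σ N (suc j) ℤ.+ (ℤ.1ℤ ℤ.- σ ℤ.* σ) ℤ.* c (suc j + N)
      ≡⟨ cong₂ (λ R s → A ℤ.* R ℤ.+ σ ℤ.* tail c σ N (suc j) ℤ.+ (ℤ.1ℤ ℤ.- s) ℤ.* c (suc j + N))
               (sym (ℤ.pos-* (growth N j) (q (j + N)))) σ² ⟩
    A ℤ.* + growth N (suc j) ℤ.+ σ ℤ.* tail c σ N (suc j) ℤ.+ ℤ.0ℤ ℤ.* c (suc j + N)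
      ≡⟨ ℤ.+-identityʳ _ ⟩
    A ℤ.* + growth N (suc j) ℤ.+ σ ℤ.* tail c σ N (suc j)  ∎
    where
    open ≡-Reasoning
    A = numerator c N
    expand : ∀ A σ W c R Q → (A ℤ.* R ℤ.+ σ ℤ.* W) ℤ.* Q ℤ.+ c
           ≡ A ℤ.* (R ℤ.* Q) ℤ.+ σ ℤ.* (W ℤ.* Q ℤ.+ σ ℤ.* c) ℤ.+ (ℤ.1ℤ ℤ.- σ ℤ.* σ) ℤ.* c
    expand = ℤ-solve-∀

  -- σ D(N) q(N) (S(N + 1 + i) − S(N)) lies in [1/2, 2]: the series beyond N is as large as its first term.
  ComparableTailsAt : (ℕ → ℤ) → ℤ → ℕ → Set
  ComparableTailsAt c σ N = ∀ i → ∃ λ v →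
    tail c σ N (suc i) ≡ + v × growthAfter N i ≤ 2 * v × v ≤ 2 * growthAfter N i

  HasComparableTails : (ℕ → ℤ) → Set
  HasComparableTails c = ∀ N → ∃ λ σ → IsSign σ × ComparableTailsAt c σ N

  ∣tail∣≤2*growth : ∀ {c σ N} → ComparableTailsAt c σ N → ∀ j → ℤ.∣ tail c σ N j ∣ ≤ 2 * growth N j
  ∣tail∣≤2*growth comparable zero = z≤n
  ∣tail∣≤2*growth {c} {σ} {N} comparable (suc i) with comparable i
  ... | v , tail≡v , _ , v≤2R = subst (_≤ 2 * growth N (suc i)) (cong ℤ.∣_∣ (sym tail≡v))
                                  (≤-trans v≤2R (*-monoʳ-≤ 2 (growthAfter≤growth N i)))

  cross-difference : ∀ c σ N j k → IsSign σ →
    numerator c (j + N) ℤ.* + D (k + N) ℤ.- numerator c (k + N) ℤ.* + D (j + N)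
      ≡ σ ℤ.* (+ D N ℤ.* (tail c σ N j ℤ.* + growth N k ℤ.- tail c σ N k ℤ.* + growth N j))
  cross-difference c σ N j k σ² = begin
    numerator c (j + N) ℤ.* + D (k + N) ℤ.- numerator c (k + N) ℤ.* + D (j + N)
      ≡⟨ cong₂ (λ Pj Pk → Pj ℤ.* + D (k + N) ℤ.- Pk ℤ.* + D (j + N))
               (numerator-split c σ N j σ²) (numerator-split c σ N k σ²) ⟩
    (A ℤ.* + Rj ℤ.+ σ ℤ.* Wj) ℤ.* + D (k + N) ℤ.- (A ℤ.* + Rk ℤ.+ σ ℤ.* Wk) ℤ.* + D (j + N)
      ≡⟨ cong₂ (λ Dk Dj → (A ℤ.* + Rj ℤ.+ σ ℤ.* Wj) ℤ.* Dk ℤ.- (A ℤ.* + Rk ℤ.+ σ ℤ.* Wk) ℤ.* Dj)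
               (trans (cong +_ (D-split N k)) (ℤ.pos-* (D N) Rk))
               (trans (cong +_ (D-split N j)) (ℤ.pos-* (D N) Rj)) ⟩
    (A ℤ.* + Rj ℤ.+ σ ℤ.* Wj) ℤ.* (+ D N ℤ.* + Rk) ℤ.- (A ℤ.* + Rk ℤ.+ σ ℤ.* Wk) ℤ.* (+ D N ℤ.* + Rj)
      ≡⟨ cancel A σ Wj Wk (+ Rj) (+ Rk) (+ D N) ⟩
    σ ℤ.* (+ D N ℤ.* (Wj ℤ.* + Rk ℤ.- Wk ℤ.* + Rj))  ∎
    where
    open ≡-Reasoning
    A  = numerator c N
    Rj = growth N j
    Rk = growth N k
    Wj = tail c σ N j
    Wk = tail c σ N k
    cancel : ∀ A σ Wj Wk Rj Rk DN →
      (A ℤ.* Rj ℤ.+ σ ℤ.* Wj) ℤ.* (DN ℤ.* Rk) ℤ.- (A ℤ.* Rk ℤ.+ σ ℤ.* Wk) ℤ.* (DN ℤ.* Rj)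
        ≡ σ ℤ.* (DN ℤ.* (Wj ℤ.* Rk ℤ.- Wk ℤ.* Rj))
    cancel = ℤ-solve-∀

  ∣cross-difference∣≤ : ∀ c σ N j k → IsSign σ → ComparableTailsAt c σ N →
    ℤ.∣ numerator c (j + N) ℤ.* + D (k + N) ℤ.- numerator c (k + N) ℤ.* + D (j + N) ∣
      ≤ D N * (4 * (growth N j * growth N k))
  ∣cross-difference∣≤ c σ N j k σ² comparable = begin
    ℤ.∣ numerator c (j + N) ℤ.* + D (k + N) ℤ.- numerator c (k + N) ℤ.* + D (j + N) ∣
      ≡⟨ cong ℤ.∣_∣ (cross-difference c σ N j k σ²) ⟩
    ℤ.∣ σ ℤ.* (+ D N ℤ.* (Wj ℤ.* + Rk ℤ.- Wk ℤ.* + Rj)) ∣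
      ≡⟨ ∣sign*i∣≡∣i∣ {σ} _ σ² ⟩
    ℤ.∣ + D N ℤ.* (Wj ℤ.* + Rk ℤ.- Wk ℤ.* + Rj) ∣
      ≡⟨ ℤ.abs-* (+ D N) _ ⟩
    D N * ℤ.∣ Wj ℤ.* + Rk ℤ.- Wk ℤ.* + Rj ∣
      ≤⟨ *-monoʳ-≤ (D N) (ℤ.∣i-j∣≤∣i∣+∣j∣ (Wj ℤ.* + Rk) (Wk ℤ.* + Rj)) ⟩
    D N * (ℤ.∣ Wj ℤ.* + Rk ∣ + ℤ.∣ Wk ℤ.* + Rj ∣)
      ≡⟨ cong₂ (λ a b → D N * (a + b)) (ℤ.abs-* Wj (+ Rk)) (ℤ.abs-* Wk (+ Rj)) ⟩
    D N * (ℤ.∣ Wj ∣ * Rk + ℤ.∣ Wk ∣ * Rj)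
      ≤⟨ *-monoʳ-≤ (D N) (+-mono-≤ (*-monoˡ-≤ Rk (∣tail∣≤2*growth comparable j))
                                    (*-monoˡ-≤ Rj (∣tail∣≤2*growth comparable k))) ⟩
    D N * (2 * Rj * Rk + 2 * Rk * Rj)
      ≡⟨ cong (D N *_) (collect Rj Rk) ⟩
    D N * (4 * (Rj * Rk))  ∎
    where
    open ≤-Reasoning
    Rj = growth N j
    Rk = growth N k
    Wj = tail c σ N j
    Wk = tail c σ N k
    collect : ∀ a b → 2 * a * b + 2 * b * a ≡ 4 * (a * b)
    collect = solve-∀

  -- |S(N + j) − S(N + k)| ≤ 4 / D(N), and D(N) ≥ N = 4E.
  cauchy : ∀ {c} → HasComparableTails c → IsCauchy (partialSum c D)
  cauchy {c} tails ε@(mkℚᵘ (+ e@(suc _)) E-1) _ with tails (4 * suc E-1)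
  ... | σ , σ² , comparable =
    N , λ m n N≤m N≤n → subst₂ (λ m n → Q.∣ partialSum c D m Q.- partialSum c D n ∣ Q.≤ ε)
                               (m∸n+n≡m N≤m) (m∸n+n≡m N≤n) (close (m ∸ N) (n ∸ N))
    where
    E = suc E-1
    N = 4 * E
    cross≤ : ∀ j k → D N * (4 * (growth N j * growth N k)) * E ≤ e * (D (j + N) * D (k + N))
    cross≤ j k = begin
      D N * (4 * (Rj * Rk)) * E       ≡⟨ reorder (D N) (Rj * Rk) E ⟩
      N * (D N * (Rj * Rk))           ≤⟨ *-monoˡ-≤ _ (n≤D N) ⟩
      D N * (D N * (Rj * Rk))         ≤⟨ m≤n*m _ e ⟩
      e * (D N * (D N * (Rj * Rk)))   ≡⟨ cong (e *_) (regroup (D N) Rj Rk) ⟩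
      e * (D N * Rj * (D N * Rk))     ≡⟨ cong₂ (λ Dj Dk → e * (Dj * Dk)) (D-split N j) (D-split N k) ⟨
      e * (D (j + N) * D (k + N))     ∎
      where
      open ≤-Reasoning
      Rj = growth N j
      Rk = growth N k
      reorder : ∀ a b c → a * (4 * b) * c ≡ (4 * c) * (a * b)
      reorder = solve-∀
      regroup : ∀ a b c → a * (a * (b * c)) ≡ a * b * (a * c)
      regroup = solve-∀
    close : ∀ j k → Q.∣ partialSum c D (j + N) Q.- partialSum c D (k + N) ∣ Q.≤ ε
    close j k = Q.≤-respˡ-≃
      (Q.≃-sym (Q.∣-∣-cong (Q.+-cong (partialSum≃numerator/D c (j + N)) (Q.-‿cong (partialSum≃numerator/D c (k + N))))))
      (cross-≤⇒distance-≤ (numerator c (j + N)) (numerator c (k + N)) e (D-pos _) (D-pos _) (s≤s z≤n)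
        (≤-trans (*-monoˡ-≤ E (∣cross-difference∣≤ c σ N j k σ² comparable)) (cross≤ j k)))

  -- far-from-multiples at N with q(N) ≥ 4b, using a partial sum within 1 / (4 D(N) q(N)) of a/b.
  irrational : ∀ {c} → HasComparableTails c → Unbounded q → ∀ r → ¬ ConvergesTo (partialSum c D) r
  irrational {c} tails q-unbounded (mkℚᵘ a b-1) converges with q-unbounded (4 * suc b-1)
  ... | N , 4b≤qN with tails N
  ... | σ , σ² , comparable with converges ((+ 1) over (4 * (D N * q N))) _
  ... | i , close with comparable i
  ... | v , tail≡v , R≤2v , v≤2R =
    far-from-multiples z (s≤s z≤n) (growthAfter-pos N i) 4b≤qN R≤2v v≤2R 4T≤Rb
    where
    b = suc b-1
    n = suc i + N
    R = growthAfter N i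
    A = numerator c N
    z = σ ℤ.* (a ℤ.* + D N ℤ.- A ℤ.* + b)
    T = ℤ.∣ + (v * b) ℤ.- z ℤ.* + (q N * R) ∣

    cross≤ : ℤ.∣ numerator c n ℤ.* + b ℤ.- a ℤ.* + D n ∣ * (4 * (D N * q N)) ≤ 1 * (D n * b)
    cross≤ = distance-≤⇒cross-≤ (numerator c n) a {D n} {b} 1 (D-pos n) (s≤s z≤n)
               (*-mono-≤ {1} {4} (s≤s z≤n) (*-mono-≤ (D-pos N) (q-pos N)))
               (Q.≤-respˡ-≃ (Q.∣-∣-cong (Q.+-cong (partialSum≃numerator/D c n) Q.≃-refl))
                            (close n (≤-trans (n≤1+n i) (m≤m+n (suc i) N))))

    difference : numerator c n ℤ.* + b ℤ.- a ℤ.* + D n ≡ σ ℤ.* (+ (v * b) ℤ.- z ℤ.* + (q N * R))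
    difference = begin
      numerator c n ℤ.* + b ℤ.- a ℤ.* + D n
        ≡⟨ cong₂ (λ P Dn → P ℤ.* + b ℤ.- a ℤ.* Dn)
                 (trans (numerator-split c σ N (suc i) σ²) (cong (λ W → A ℤ.* + Rf ℤ.+ σ ℤ.* W) tail≡v))
                 (trans (cong +_ (D-split N (suc i))) (ℤ.pos-* (D N) Rf)) ⟩
      (A ℤ.* + Rf ℤ.+ σ ℤ.* + v) ℤ.* + b ℤ.- a ℤ.* (+ D N ℤ.* + Rf)
        ≡⟨ expand A σ (+ v) (+ b) a (+ D N) (+ Rf) ⟩
      σ ℤ.* (+ v ℤ.* + b ℤ.- z ℤ.* + Rf) ℤ.+ (ℤ.1ℤ ℤ.- σ ℤ.* σ) ℤ.* ((A ℤ.* + b ℤ.- a ℤ.* + D N) ℤ.* + Rf)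
        ≡⟨ cong₂ (λ vb s → σ ℤ.* (vb ℤ.- z ℤ.* + Rf) ℤ.+ (ℤ.1ℤ ℤ.- s) ℤ.* X) (sym (ℤ.pos-* v b)) σ² ⟩
      σ ℤ.* (+ (v * b) ℤ.- z ℤ.* + Rf) ℤ.+ ℤ.0ℤ ℤ.* X
        ≡⟨ ℤ.+-identityʳ _ ⟩
      σ ℤ.* (+ (v * b) ℤ.- z ℤ.* + Rf)
        ≡⟨ cong (λ m → σ ℤ.* (+ (v * b) ℤ.- z ℤ.* + m)) (growth-suc N i) ⟩
      σ ℤ.* (+ (v * b) ℤ.- z ℤ.* + (q N * R))  ∎
      where
      open ≡-Reasoning
      Rf = growth N (suc i)
      X = (A ℤ.* + b ℤ.- a ℤ.* + D N) ℤ.* + Rf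
      expand : ∀ A σ v b a DN Rf →
        (A ℤ.* Rf ℤ.+ σ ℤ.* v) ℤ.* b ℤ.- a ℤ.* (DN ℤ.* Rf)
          ≡ σ ℤ.* (v ℤ.* b ℤ.- σ ℤ.* (a ℤ.* DN ℤ.- A ℤ.* b) ℤ.* Rf)
            ℤ.+ (ℤ.1ℤ ℤ.- σ ℤ.* σ) ℤ.* ((A ℤ.* b ℤ.- a ℤ.* DN) ℤ.* Rf)
      expand = ℤ-solve-∀

    4T≤Rb : 4 * T ≤ R * b
    4T≤Rb = *-cancelˡ-≤ (D N * q N) {{>-nonZero (*-mono-≤ (D-pos N) (q-pos N))}}
      (subst₂ _≤_ (reorderˡ T (D N) (q N))
                  (trans (cong (λ Dn → 1 * (Dn * b)) (trans (D-split N (suc i)) (cong (D N *_) (growth-suc N i))))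
                         (reorderʳ (D N) (q N) R b))
                  (subst (λ t → t * (4 * (D N * q N)) ≤ 1 * (D n * b))
                         (trans (cong ℤ.∣_∣ difference) (∣sign*i∣≡∣i∣ {σ} _ σ²)) cross≤))
      where
      reorderˡ : ∀ t d k → t * (4 * (d * k)) ≡ d * k * (4 * t)
      reorderˡ = solve-∀
      reorderʳ : ∀ d k r b → 1 * (d * (k * r) * b) ≡ d * k * (r * b)
      reorderʳ = solve-∀

  tail-one : ∀ N i → ∃ λ v → tail one ℤ.1ℤ N (suc i) ≡ + v × growthAfter N i ≤ v × v + 1 ≤ 2 * growthAfter N i
  tail-one N zero    = 1 , refl , ≤-refl , s≤s (s≤s z≤n)
  tail-one N (suc i) with tail-one N i
  ... | v , tail≡v , R≤v , v+1≤2R = v * Q + 1 , tail≡vQ+1 , RQ≤vQ+1 , vQ+2≤2RQ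
    where
    Q = q (suc i + N)
    R = growthAfter N i
    tail≡vQ+1 : tail one ℤ.1ℤ N (suc (suc i)) ≡ + (v * Q + 1)
    tail≡vQ+1 = trans (cong (λ W → W ℤ.* + Q ℤ.+ ℤ.1ℤ) tail≡v)
                      (trans (cong (ℤ._+ ℤ.1ℤ) (sym (ℤ.pos-* v Q))) (sym (ℤ.pos-+ (v * Q) 1)))
    RQ≤vQ+1 : R * Q ≤ v * Q + 1
    RQ≤vQ+1 = ≤-trans (*-monoˡ-≤ Q R≤v) (m≤m+n (v * Q) 1)
    vQ+2≤2RQ : v * Q + 1 + 1 ≤ 2 * (R * Q)
    vQ+2≤2RQ = begin
      v * Q + 1 + 1  ≡⟨ +-assoc (v * Q) 1 1 ⟩
      v * Q + 2      ≤⟨ +-monoʳ-≤ (v * Q) (2≤q (s≤s z≤n)) ⟩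
      v * Q + Q      ≡⟨ m*n+n≡[m+1]*n v Q ⟩
      (v + 1) * Q    ≤⟨ *-monoˡ-≤ Q v+1≤2R ⟩
      2 * R * Q      ≡⟨ *-assoc 2 R Q ⟩
      2 * (R * Q)    ∎
      where open ≤-Reasoning

  comparableTails-one : HasComparableTails one
  comparableTails-one N = ℤ.1ℤ , refl , λ i →
    let v , tail≡v , R≤v , v+1≤2R = tail-one N i
    in v , tail≡v , ≤-trans R≤v (m≤n*m v 2) , ≤-trans (m≤m+n v 1) v+1≤2R

  nextSign : ℕ → ℕ → ℤ
  nextSign N i = alt (suc N) ℤ.* alt (suc (suc i) + N)

  nextSign-zero : ∀ N → nextSign N 0 ≡ ℤ.-1ℤ
  nextSign-zero N = begin
    alt (suc N) ℤ.* alt (suc (suc N))       ≡⟨ cong (alt (suc N) ℤ.*_) (alt-suc (suc N)) ⟩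
    alt (suc N) ℤ.* ℤ.- alt (suc N)         ≡⟨ ℤ.neg-distribʳ-* (alt (suc N)) (alt (suc N)) ⟨
    ℤ.- (alt (suc N) ℤ.* alt (suc N))       ≡⟨ cong ℤ.-_ (alt-sign (suc N)) ⟩
    ℤ.-1ℤ                                   ∎
    where open ≡-Reasoning

  nextSign-suc : ∀ N i → nextSign N (suc i) ≡ ℤ.- nextSign N i
  nextSign-suc N i = trans (cong (alt (suc N) ℤ.*_) (alt-suc (suc (suc i) + N)))
                           (sym (ℤ.neg-distribʳ-* (alt (suc N)) (alt (suc (suc i) + N))))

  -- Relative to its first term, the alternating tail lies in (1/2, 1] or [1/2, 1), according to the next sign.
  AlternatingTailBounds : ℕ → ℕ → ℕ → Set
  AlternatingTailBounds N i v =
    (nextSign N i ≡ ℤ.-1ℤ × v ≤ growthAfter N i × growthAfter N i + 1 ≤ 2 * v) ⊎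
    (nextSign N i ≡ ℤ.1ℤ × v + 1 ≤ growthAfter N i × growthAfter N i ≤ 2 * v)

  tail-alt : ∀ N i → ∃ λ v → tail alt (alt (suc N)) N (suc i) ≡ + v × AlternatingTailBounds N i v
  tail-alt N zero = 1 , trans (ℤ.+-identityˡ _) (alt-sign (suc N)) , inj₁ (nextSign-zero N , ≤-refl , s≤s (s≤s z≤n))
  tail-alt N (suc i) with tail-alt N i
  ... | v , tail≡v , inj₁ (sign≡-1 , v≤R , R+1≤2v)
    with vQ-1-bounds v (growthAfter N i) (q (suc i + N)) (2≤q (s≤s z≤n)) v≤R R+1≤2v
  ...   | v′ , vQ≡1+v′ , v′+1≤RQ , RQ≤2v′ =
    v′ , tail≡v′ , inj₂ (trans (nextSign-suc N i) (cong ℤ.-_ sign≡-1) , v′+1≤RQ , RQ≤2v′)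
    where
    tail≡v′ : tail alt (alt (suc N)) N (suc (suc i)) ≡ + v′
    tail≡v′ = trans (cong₂ (λ W s → W ℤ.* + q (suc i + N) ℤ.+ s) tail≡v sign≡-1)
                    (cong (ℤ._+ ℤ.-1ℤ) (trans (sym (ℤ.pos-* v (q (suc i + N)))) (cong +_ vQ≡1+v′)))
  tail-alt N (suc i) | v , tail≡v , inj₂ (sign≡1 , v+1≤R , R≤2v) =
    v * Q + 1 , tail≡vQ+1 , inj₁ (trans (nextSign-suc N i) (cong ℤ.-_ sign≡1) , proj₁ bounds , proj₂ bounds)
    where
    Q = q (suc i + N)
    bounds = vQ+1-bounds v (growthAfter N i) Q (2≤q (s≤s z≤n)) v+1≤R R≤2v
    tail≡vQ+1 : tail alt (alt (suc N)) N (suc (suc i)) ≡ + (v * Q + 1)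
    tail≡vQ+1 = trans (cong₂ (λ W s → W ℤ.* + Q ℤ.+ s) tail≡v sign≡1)
                      (trans (cong (ℤ._+ ℤ.1ℤ) (sym (ℤ.pos-* v Q))) (sym (ℤ.pos-+ (v * Q) 1)))

  comparableTails-alt : HasComparableTails alt
  comparableTails-alt N = alt (suc N) , alt-sign (suc N) , λ i → comparable {i} (tail-alt N i)
    where
    comparable : ∀ {i} → (∃ λ v → tail alt (alt (suc N)) N (suc i) ≡ + v × AlternatingTailBounds N i v) →
      ∃ λ v → tail alt (alt (suc N)) N (suc i) ≡ + v × growthAfter N i ≤ 2 * v × v ≤ 2 * growthAfter N i
    comparable (v , tail≡v , inj₁ (_ , v≤R , R+1≤2v)) =
      v , tail≡v , ≤-trans (m≤m+n _ 1) R+1≤2v , ≤-trans v≤R (m≤n*m _ 2)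
    comparable (v , tail≡v , inj₂ (_ , v+1≤R , R≤2v)) =
      v , tail≡v , R≤2v , ≤-trans (≤-trans (m≤m+n v 1) v+1≤R) (m≤n*m _ 2)

  sumIrrational : ∀ {c} → HasComparableTails c → Unbounded q → SumIrrational c D
  sumIrrational tails q-unbounded = cauchy tails , irrational tails q-unbounded

mainTheorem3 : (k : ℕ) → 1 ≤ k →
    (x : Fin k → ℕ → ℕ) →
    (∀ j → PositiveSeq (x j)) → (∀ j → Superadditive (x j)) →
    (A : Fin k → ℕ → ℕ → ℕ) → (∀ j → IsArray (x j) (A j)) →
    (y : ℕ → ℕ) → IsExpVonMangoldt y →
    (s : Fin k → ℕ) → (∃ λ j → s j ≢ 0) →
    SumIrrational one (denom A y s) × SumIrrational alt (denom A y s)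
mainTheorem3 k _ x x-pos _ A arrays y y-spec s (j , sj≢0) =
  sumIrrational comparableTails-one ratio-unbounded , sumIrrational comparableTails-alt ratio-unbounded
  where
  open Denominator x-pos arrays y-spec s
  bounds : BoundsPrimeDivisorsOfSuc ratio
  bounds = ratio-bounds-prime-divisors j (n≢0⇒n>0 sj≢0)
  ratio-unbounded : Unbounded ratio
  ratio-unbounded = bounds-prime-divisors⇒unbounded bounds
  open Series (denom A y s) ratio denom-zero denom-suc ratio-pos (bounds-prime-divisors⇒2≤ bounds)
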